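{- Let $s,m,n$ be positive integers and let $X\subseteq\{0,1,\dots,m-1\}^n$ be reducible. Then for every non-empty $Y\subseteq In(X,s)$ there is $i\in[n]$ such that $MinDeg_i(Y)\le s$.
   Context: $In(X,s)=\{(sx_1+r_1,\dots,sx_n+r_n):(x_1,\dots,x_n)\in X,\ r_1,\dots,r_n\in\{0,1,\dots,s-1\}\}\subseteq\{0,1,\dots,sm-1\}^n$. For $Y\subseteq A^n$ ($A$ finite) and $i\in[n]$, $G_i(Y)$ is the bipartite graph with left vertices $A$, right vertices the projection $Y_{[n]\setminus\{i\}}$ of $Y$ onto all coordinates but the $i$-th, and $a$ adjacent to $(y_1,\dots,y_{i-1},y_{i+1},\dots,y_n)$ iff $(y_1,\dots,y_{i-1},a,y_{i+1},\dots,y_n)\in Y$; $MinDeg_i(Y)$ is the minimum degree of a right vertex of $G_i(Y)$. A set $X\subseteq\{0,\dots,m-1\}^n$ is reducible if every non-empty $Z\subseteq X$ has some $i\in[n]$ with $MinDeg_i(Z)=1$. -}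

module Defs where

open import Data.Nat using (ℕ; zero; suc; _+_; _*_; _⊓_)
open import Data.Fin using (Fin; toℕ)
open import Data.Vec using (Vec; []; _∷_; lookup; _[_]≔_)
open import Data.List using (List; [_]; concatMap; map; allFin; foldr)
open import Data.Nat.ListAction using (sum)
open import Data.Bool using (Bool; true; false; if_then_else_)
open import Data.Product using (Σ; _×_; ∃)
open import Relation.Binary.PropositionalEquality using (_≡_)

Point : ℕ → ℕ → Set
Point k n = Vec (Fin k) n

SubsetOf : ℕ → ℕ → Set
SubsetOf k n = Point k n → Bool

_⊆_ : ∀ {k n} → SubsetOf k n → SubsetOf k n → Set
Z ⊆ X = ∀ z → Z z ≡ true → X z ≡ true

NonEmpty : ∀ {k n} → SubsetOf k n → Set
NonEmpty Y = ∃ λ y → Y y ≡ true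

allPoints : ∀ k n → List (Point k n)
allPoints k zero = [ [] ]
allPoints k (suc n) = concatMap (λ a → map (a ∷_) (allPoints k n)) (allFin k)

-- Degree in G_i(Y) of the right vertex obtained by deleting coordinate i of y:
-- the number of a ∈ A with (y_1,…,y_{i-1},a,y_{i+1},…,y_n) ∈ Y.
deg : ∀ {k n} → Fin n → SubsetOf k n → Point k n → ℕ
deg {k} i Y y = sum (map (λ a → if Y (y [ i ]≔ a) then 1 else 0) (allFin k))

-- Right vertices are
-- exactly the projections of points y ∈ Y, so we minimise deg over y ∈ Y.
-- (Starting value k is an upper bound on every degree; for empty Y the value
-- is k, a convention irrelevant here since MinDeg is only used for non-empty sets.)
MinDeg : ∀ {k n} → Fin n → SubsetOf k n → ℕ
MinDeg {k} {n} i Y =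
  foldr (λ y acc → if Y y then deg i Y y ⊓ acc else acc) k (allPoints k n)

Reducible : ∀ {m n} → SubsetOf m n → Set
Reducible {m} {n} X =
  (Z : SubsetOf m n) → Z ⊆ X → NonEmpty Z → ∃ λ (i : Fin n) → MinDeg i Z ≡ 1

InBlowup : ∀ {m n} → SubsetOf m n → (s : ℕ) → Point (s * m) n → Set
InBlowup {m} {n} X s y =
  Σ (Point m n) λ x → Σ (Point s n) λ r →
    X x ≡ true × (∀ j → toℕ (lookup y j) ≡ s * toℕ (lookup x j) + toℕ (lookup r j))

-- Collapse each point of Y ⊆ In(X,s) to the block of the s-grid containing it.  The image Z of
-- Y lies in X, so reducibility yields a direction i and a point z ∈ Z whose i-fibre in Z is
-- the single value z_i.  For any y ∈ Y above z, every a with y[i ≔ a] ∈ Y then lies in the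
-- block of z_i, which has only s elements, so MinDeg_i(Y) ≤ deg_i(Y, y) ≤ s.
module Submission where

open import Defs
open import Function using (_∘_; Equivalence)
open import Data.Nat using (ℕ; zero; suc; _*_; _+_; _≤_; _<_; _⊓_; NonZero; z≤n; s≤s; s≤s⁻¹)
open import Data.Nat.Properties
  using (⊓-sel; m⊓n≤m; m⊓n≤n; ≤-trans; ≤-reflexive; m≤m+n; m≤n+m; <⇒≤; +-monoʳ-<; *-comm)
open import Data.Fin using (Fin; zero; suc; toℕ; cast; combine; quotient; remainder)
  renaming (_≟_ to _≟ᶠ_)
open import Data.Fin.Properties
  using (toℕ-cast; toℕ-injective; toℕ-combine; remQuot-combine; combine-remQuot; toℕ<n)
open import Data.Vec using ([]; _∷_; lookup; _[_]≔_) renaming (map to vmap)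
open import Data.Vec.Properties using (map-[]≔; []≔-lookup; ≡-dec)
open import Data.List using (List; []; _∷_; foldr; map; tabulate)
open import Data.Bool.ListAction using (any)
open import Data.List.Properties using (map-tabulate)
open import Data.List.Membership.Propositional using (_∈_; lose)
open import Data.List.Membership.Propositional.Properties using (∈-concatMap⁺; ∈-map⁺; ∈-allFin)
open import Data.List.Relation.Unary.Any using (here; there; satisfied)
open import Data.List.Relation.Unary.Any.Properties using (any⁺; any⁻)
open import Data.Nat.ListAction using (sum)
open import Data.Bool using (Bool; true; false; if_then_else_; _∧_)
open import Data.Bool.Properties using (T-≡; T-∧)
open import Data.Product using (∃; _,_; proj₁; proj₂; _×_)
import Data.Product as Product
open import Data.Sum using (inj₁; inj₂)
open import Relation.Nullary using (contradiction)
open import Relation.Nullary.Decidable using (⌊_⌋; fromWitness; toWitness)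
open import Relation.Binary.PropositionalEquality
  using (_≡_; refl; sym; trans; cong; cong₂; subst; module ≡-Reasoning)

count : ∀ {k} → (Fin k → Bool) → ℕ
count P = sum (tabulate (λ a → if P a then 1 else 0))

count-window : ∀ {k} (P : Fin k → Bool) c s →
  (∀ a → P a ≡ true → c ≤ toℕ a × toℕ a < c + s) → count P ≤ s
count-window {zero} P c s inside = z≤n
count-window {suc k} P (suc c) s inside with P zero in P0
... | true = contradiction (proj₁ (inside zero P0)) λ ()
... | false = count-window (P ∘ suc) c s (λ a Pa → Product.map s≤s⁻¹ s≤s⁻¹ (inside (suc a) Pa))
count-window {suc k} P zero s inside with P zero in P0
count-window {suc k} P zero zero inside | true = contradiction (proj₂ (inside zero P0)) λ ()
count-window {suc k} P zero (suc s) inside | true =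
  s≤s (count-window (P ∘ suc) zero s (λ a Pa → z≤n , s≤s⁻¹ (proj₂ (inside (suc a) Pa))))
count-window {suc k} P zero s inside | false =
  count-window (P ∘ suc) zero s (λ a Pa → z≤n , <⇒≤ (proj₂ (inside (suc a) Pa)))

count-≤ : ∀ {k} (P : Fin k → Bool) → count P ≤ k
count-≤ {k} P = count-window P zero k (λ a _ → z≤n , toℕ<n a)

count-pos : ∀ {k} (P : Fin k → Bool) {a} → P a ≡ true → 0 < count P
count-pos P {zero} Pa rewrite Pa = s≤s z≤n
count-pos P {suc a} Pa = ≤-trans (count-pos (P ∘ suc) Pa) (m≤n+m _ _)

count≤1⇒unique : ∀ {k} (P : Fin k → Bool) {a b} → count P ≤ 1 → P a ≡ true → P b ≡ true → a ≡ b
count≤1⇒unique P {zero} {zero} _ _ _ = refl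
count≤1⇒unique P {zero} {suc b} c≤1 Pa Pb rewrite Pa =
  contradiction (≤-trans (count-pos (P ∘ suc) Pb) (s≤s⁻¹ c≤1)) λ ()
count≤1⇒unique P {suc a} {zero} c≤1 Pa Pb = sym (count≤1⇒unique P c≤1 Pb Pa)
count≤1⇒unique P {suc a} {suc b} c≤1 Pa Pb =
  cong suc (count≤1⇒unique (P ∘ suc) (≤-trans (m≤n+m _ _) c≤1) Pa Pb)

minOver : {A : Set} → (A → Bool) → (A → ℕ) → ℕ → List A → ℕ
minOver P f d = foldr (λ y acc → if P y then f y ⊓ acc else acc) d

minOver-≤ : ∀ {A : Set} (P : A → Bool) (f : A → ℕ) d {L y} →
  y ∈ L → P y ≡ true → minOver P f d L ≤ f y
minOver-≤ P f d (here refl) Py rewrite Py = m⊓n≤m _ _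
minOver-≤ P f d {x ∷ L} (there y∈L) Py with P x
... | true = ≤-trans (m⊓n≤n _ _) (minOver-≤ P f d y∈L Py)
... | false = minOver-≤ P f d y∈L Py

minOver-attained : ∀ {A : Set} (P : A → Bool) (f : A → ℕ) d L {y₀} → P y₀ ≡ true → f y₀ ≤ d →
  ∃ λ y → P y ≡ true × f y ≤ minOver P f d L
minOver-attained P f d [] Py₀ fy₀≤d = _ , Py₀ , fy₀≤d
minOver-attained P f d (x ∷ L) Py₀ fy₀≤d with P x in Px | ⊓-sel (f x) (minOver P f d L)
... | true | inj₁ min≡fx = x , Px , ≤-reflexive (sym min≡fx)
... | true | inj₂ min≡rest rewrite min≡rest = minOver-attained P f d L Py₀ fy₀≤d
... | false | _ = minOver-attained P f d L Py₀ fy₀≤d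

∈-allPoints : ∀ {k n} (y : Point k n) → y ∈ allPoints k n
∈-allPoints [] = here refl
∈-allPoints {k} {suc n} (a ∷ y) =
  ∈-concatMap⁺ (λ b → map (b ∷_) (allPoints k n)) (lose (∈-allFin a) (∈-map⁺ (a ∷_) (∈-allPoints y)))

deg-as-count : ∀ {k n} (i : Fin n) (Y : SubsetOf k n) y → deg i Y y ≡ count (λ a → Y (y [ i ]≔ a))
deg-as-count {k} i Y y = cong sum (map-tabulate {n = k} (λ a → a) (λ a → if Y (y [ i ]≔ a) then 1 else 0))

MinDeg-≤-deg : ∀ {k n} (i : Fin n) (Y : SubsetOf k n) {y} → Y y ≡ true → MinDeg i Y ≤ deg i Y y
MinDeg-≤-deg {k} i Y {y} = minOver-≤ Y (deg i Y) k (∈-allPoints y)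

deg-≤ : ∀ {k n} (i : Fin n) (Y : SubsetOf k n) y → deg i Y y ≤ k
deg-≤ {k} i Y y = subst (_≤ k) (sym (deg-as-count i Y y)) (count-≤ _)

MinDeg≡1⇒singleton-fibre : ∀ {k n} (i : Fin n) (Y : SubsetOf k n) → NonEmpty Y → MinDeg i Y ≡ 1 →
  ∃ λ y → Y y ≡ true × (∀ a → Y (y [ i ]≔ a) ≡ true → a ≡ lookup y i)
MinDeg≡1⇒singleton-fibre {k} {n} i Y (y₀ , Yy₀) MinDeg≡1
  with y , Yy , deg≤MinDeg ← minOver-attained Y (deg i Y) k (allPoints k n) Yy₀ (deg-≤ i Y y₀)
  = y , Yy , λ a Ya → count≤1⇒unique _ deg≤1 Ya Y-at-yᵢ
  where
  deg≤1 : count (λ a → Y (y [ i ]≔ a)) ≤ 1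
  deg≤1 = subst (_≤ 1) (deg-as-count i Y y) (≤-trans deg≤MinDeg (≤-reflexive MinDeg≡1))
  Y-at-yᵢ : Y (y [ i ]≔ lookup y i) ≡ true
  Y-at-yᵢ = subst (λ w → Y w ≡ true) (sym ([]≔-lookup y i)) Yy

-- Opaque, so that f, Y and x can be inferred from a hypothesis  image f Y x ≡ true.
opaque
  image : ∀ {k l n} → (Point k n → Point l n) → SubsetOf k n → SubsetOf l n
  image {k} {n = n} f Y x = any (λ y → Y y ∧ ⌊ ≡-dec _≟ᶠ_ (f y) x ⌋) (allPoints k n)

  image-intro : ∀ {k l n} {f : Point k n → Point l n} {Y : SubsetOf k n} {y} →
    Y y ≡ true → image f Y (f y) ≡ true
  image-intro {f = f} {Y} {y} Yy = Equivalence.to T-≡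
    (any⁺ (λ y' → Y y' ∧ ⌊ ≡-dec _≟ᶠ_ (f y') (f y) ⌋)
      (lose (∈-allPoints y) (Equivalence.from T-∧ (Equivalence.from T-≡ Yy , fromWitness refl))))

  image-elim : ∀ {k l n} {f : Point k n → Point l n} {Y : SubsetOf k n} {x} → image f Y x ≡ true →
    ∃ λ y → Y y ≡ true × f y ≡ x
  image-elim {k} {n = n} {f} {Y} {x} x∈image
    with y , Y∧fy≡x ← satisfied (any⁻ (λ y' → Y y' ∧ ⌊ ≡-dec _≟ᶠ_ (f y') x ⌋) (allPoints k n)
                                       (Equivalence.from T-≡ x∈image))
    with Yy , fy≡x ← Equivalence.to T-∧ Y∧fy≡x
    = y , Equivalence.to T-≡ Yy , toWitness fy≡x

module Blowup (s m : ℕ) where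

  block : Fin (s * m) → Fin m
  block a = quotient s (cast (*-comm s m) a)

  offset : Fin (s * m) → Fin s
  offset a = remainder {m} s (cast (*-comm s m) a)

  toℕ-block : ∀ a → toℕ a ≡ s * toℕ (block a) + toℕ (offset a)
  toℕ-block a = begin
    toℕ a                               ≡⟨ toℕ-cast (*-comm s m) a ⟨
    toℕ (cast (*-comm s m) a)           ≡⟨ cong toℕ (combine-remQuot {m} s (cast (*-comm s m) a)) ⟨
    toℕ (combine (block a) (offset a))  ≡⟨ toℕ-combine (block a) (offset a) ⟩
    s * toℕ (block a) + toℕ (offset a)  ∎
    where open ≡-Reasoning

  block-unique : ∀ a b (r : Fin s) → toℕ a ≡ s * toℕ b + toℕ r → block a ≡ b
  block-unique a b r toℕ-a = begin
    quotient s (cast (*-comm s m) a)  ≡⟨ cong (quotient s) cast-a≡combine ⟩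
    quotient s (combine b r)          ≡⟨ cong proj₁ (remQuot-combine b r) ⟩
    b                                 ∎
    where
    open ≡-Reasoning
    cast-a≡combine : cast (*-comm s m) a ≡ combine b r
    cast-a≡combine = toℕ-injective (trans (toℕ-cast (*-comm s m) a) (trans toℕ-a (sym (toℕ-combine b r))))

  blocks : ∀ {n} → Point (s * m) n → Point m n
  blocks = vmap block

  blocks-unique : ∀ {n} (y : Point (s * m) n) (x : Point m n) (r : Point s n) →
    (∀ j → toℕ (lookup y j) ≡ s * toℕ (lookup x j) + toℕ (lookup r j)) → blocks y ≡ x
  blocks-unique [] [] [] _ = refl
  blocks-unique (a ∷ y) (b ∷ x) (c ∷ r) digits =
    cong₂ _∷_ (block-unique a b c (digits zero)) (blocks-unique y x r (digits ∘ suc))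

  InBlowup⇒blocks∈ : ∀ {n} {X : SubsetOf m n} {y} → InBlowup X s y → X (blocks y) ≡ true
  InBlowup⇒blocks∈ {X = X} {y} (x , r , Xx , digits) =
    subst (λ w → X w ≡ true) (sym (blocks-unique y x r digits)) Xx

  deg-≤-block : ∀ {n} (i : Fin n) (Y : SubsetOf (s * m) n) y b →
    (∀ a → Y (y [ i ]≔ a) ≡ true → block a ≡ b) → deg i Y y ≤ s
  deg-≤-block i Y y b fibre rewrite deg-as-count i Y y = count-window _ (s * toℕ b) s inside
    where
    inside : ∀ a → Y (y [ i ]≔ a) ≡ true → s * toℕ b ≤ toℕ a × toℕ a < s * toℕ b + s
    inside a Ya rewrite toℕ-block a | fibre a Ya = m≤m+n _ _ , +-monoʳ-< (s * toℕ b) (toℕ<n (offset a))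

  deg-≤-of-singleton-image-fibre : ∀ {n} (i : Fin n) (Y : SubsetOf (s * m) n) y →
    (∀ b → image blocks Y (blocks y [ i ]≔ b) ≡ true → b ≡ lookup (blocks y) i) → deg i Y y ≤ s
  deg-≤-of-singleton-image-fibre i Y y singleton = deg-≤-block i Y y _ λ a Ya →
    singleton (block a) (subst (λ w → image blocks Y w ≡ true) (map-[]≔ block y i) (image-intro Ya))

lemma7 : (s m n : ℕ) → NonZero s → NonZero m → NonZero n →
         (X : SubsetOf m n) → Reducible X →
         (Y : SubsetOf (s * m) n) → (∀ y → Y y ≡ true → InBlowup X s y) →
         NonEmpty Y → ∃ λ (i : Fin n) → MinDeg i Y ≤ s
lemma7 s m n _ _ _ X reducible Y Y⊆In (y₀ , Yy₀) = small-degree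
  where
  open Blowup s m
  Z : SubsetOf m n
  Z = image blocks Y
  Z⊆X : Z ⊆ X
  Z⊆X x Zx with y , Yy , refl ← image-elim Zx = InBlowup⇒blocks∈ (Y⊆In y Yy)
  Z-nonempty : NonEmpty Z
  Z-nonempty = blocks y₀ , image-intro Yy₀
  small-degree : ∃ λ (i : Fin n) → MinDeg i Y ≤ s
  small-degree
    with i , MinDeg≡1 ← reducible Z Z⊆X Z-nonempty
    with _ , Zz , singleton ← MinDeg≡1⇒singleton-fibre i Z Z-nonempty MinDeg≡1
    with y , Yy , refl ← image-elim Zz
    = i , ≤-trans (MinDeg-≤-deg i Y Yy) (deg-≤-of-singleton-image-fibre i Y y singleton)
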